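{- For every integer $c\geq 2$ there exist a finite set $V$ and edge sets $E_1,E_2\subseteq\binom{V}{2}$ such that the simple graphs $G_1=(V,E_1)$ and $G_2=(V,E_2)$ satisfy $\mathsf{c}(G_1)\geq c$ and $\mathsf{c}(G_2)\geq c$, while the multi-layer graph $(V,\{E_1,E_2\},*)$ has multi-layer cop number exactly $2$.
   Context: For a simple graph $G$, $\mathsf{c}(G)$ is its (classical) cop number: the least number of cops that have a winning strategy in the cops and robber game on $G$ (cops placed first, then the robber, alternating turns starting with the cops, each agent stays or moves along one edge per turn, cops win if one occupies the robber's vertex). A multi-layer graph with designated layers is $(V,\{C_1,\dots,C_\tau\},R)$ with cop layers $C_i\subseteq\binom V2$ and robber layer $R\subseteq\binom V2$; $(V,\{C_1,\dots,C_\tau\},*)$ means $R=C_1\cup\dots\cup C_\tau$. In the multi-layer game with allocation $(k_1,\dots,k_\tau)$, $k_i$ cops are assigned to layer $C_i$ and move only along edges of $C_i$, the robber moves only along edges of $R$, otherwise the rules are as in the classical game. The multi-layer cop number is the least $k$ such that some allocation with $\sum_i k_i=k$ gives the cop player a winning strategy. -}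

module Defs where

open import Data.Nat using (ℕ; _<_; _≤_)
open import Data.Fin using (Fin)
open import Data.Bool using (Bool; true)
open import Data.Vec using (Vec; lookup; sum)
open import Data.Product using (Σ; ∃; _×_; _,_; proj₁)
open import Data.Sum using (_⊎_)
open import Relation.Binary.PropositionalEquality using (_≡_; _≢_)
open import Relation.Nullary using (¬_)

-- An edge set E ⊆ (V choose 2) is encoded by a
-- Bool-valued function; the unordered pair {u,v} (u ≠ v) belongs to E iff
-- E u v ≡ true or E v u ≡ true.  (Every such function denotes a subset of
-- (V choose 2), and every subset arises.)
Edges : ℕ → Set
Edges n = Fin n → Fin n → Bool

Adj : ∀ {n} → Edges n → Fin n → Fin n → Set
Adj E u v = u ≢ v × (E u v ≡ true ⊎ E v u ≡ true)

Step : ∀ {n} → (Fin n → Fin n → Set) → Fin n → Fin n → Set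
Step A u v = u ≡ v ⊎ A u v

module Game {n : ℕ} (I : Set) (CA : I → Fin n → Fin n → Set)
            (RA : Fin n → Fin n → Set) where

  Pos : Set
  Pos = I → Fin n

  Caught : Pos → Fin n → Set
  Caught cs r = ∃ λ i → cs i ≡ r

  CopsStep : Pos → Pos → Set
  CopsStep cs cs′ = ∀ i → Step (CA i) (cs i) (cs′ i)

  -- CopWin cs r : position with cops at cs, robber at r, cops to move,
  -- from which the cops can force capture (a well-founded winning
  -- strategy tree: every play consistent with it ends in capture).
  data CopWin (cs : Pos) (r : Fin n) : Set where
    caught : Caught cs r → CopWin cs r
    move   : (cs′ : Pos) → CopsStep cs cs′ →
             (Caught cs′ r ⊎ (∀ r′ → Step RA r r′ → CopWin cs′ r′)) →
             CopWin cs r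

  -- the cop player has a winning strategy: cops are placed first, then the
  -- robber, then play alternates starting with the cops.
  CopsWin : Set
  CopsWin = Σ Pos λ cs → ∀ r → CopWin cs r

ClassicalCopsWin : ∀ {n} → Edges n → ℕ → Set
ClassicalCopsWin {n} E k = Game.CopsWin (Fin k) (λ _ → Adj E) (Adj E)

IsCopNumber : ∀ {n} → Edges n → ℕ → Set
IsCopNumber E m = ClassicalCopsWin E m × (∀ k → k < m → ¬ ClassicalCopsWin E k)

-- Robber layer R = C_1 ∪ … ∪ C_τ  (the "*" convention)
UnionAdj : ∀ {n τ} → (Fin τ → Edges n) → Fin n → Fin n → Set
UnionAdj C u v = ∃ λ i → Adj (C i) u v

MultiLayerCopsWin : ∀ {n τ} → (Fin τ → Edges n) → (Fin n → Fin n → Set) →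
                    Vec ℕ τ → Set
MultiLayerCopsWin {n} {τ} C R k =
  Game.CopsWin (Σ (Fin τ) λ i → Fin (lookup k i)) (λ c → Adj (C (proj₁ c))) R

MultiLayerWinsWith : ∀ {n τ} → (Fin τ → Edges n) → (Fin n → Fin n → Set) →
                     ℕ → Set
MultiLayerWinsWith {τ = τ} C R m =
  Σ (Vec ℕ τ) λ k → sum k ≡ m × MultiLayerCopsWin C R k

IsMultiLayerCopNumber : ∀ {n τ} → (Fin τ → Edges n) → (Fin n → Fin n → Set) →
                        ℕ → Set
IsMultiLayerCopNumber C R m =
  MultiLayerWinsWith C R m × (∀ k → k < m → ¬ MultiLayerWinsWith C R k)

-- Each layer is a star K_{1,c} together with c + 1 isolated vertices, the two
-- stars living on complementary halves of the vertex set.  A graph whose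
-- components each have a dominating vertex needs exactly one cop per component,
-- so each layer alone has cop number c + 2.  In the multi-layer game one cop on
-- each star centre covers every vertex in one move, while a single cop is
-- confined to one component of its layer and the robber can wait in another.
module Submission where

open import Defs
open import Data.Nat using (ℕ; zero; suc; _+_; _<_; _≤_; s≤s; z≤n; z<s)
open import Data.Nat.Properties using (m≤n+m; <-trans)
open import Data.Fin using (Fin; zero; suc; _≟_)
open import Data.Fin.Properties using (pigeonhole; any?; ¬∀⟶∃¬; <⇒≢; +↔⊎)
open import Data.Vec using (Vec; _∷_; []; lookup)
open import Data.Product using (Σ; _×_; _,_; ∃; proj₁; proj₂)
open import Data.Product.Properties using (≡-dec)
open import Data.Sum using (_⊎_; inj₁; inj₂; swap)
open import Data.Sum.Properties using (swap-↔)
open import Data.Bool using (Bool; true; false)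
open import Data.Empty using (⊥)
open import Function using (_↔_; Inverse; _∘_)
open import Function.Construct.Composition using (_↔-∘_)
open import Relation.Nullary using (¬_; yes; no; contradiction)
open import Relation.Binary.Definitions using (DecidableEquality)
open import Relation.Binary.PropositionalEquality
  using (_≡_; _≢_; refl; sym; trans; cong; subst)

missed-value : ∀ {k m} → k < m → (f : Fin k → Fin m) → ∃ λ j → ∀ i → f i ≢ j
missed-value {m = m} k<m f
  with ¬∀⟶∃¬ m (λ j → ∃ λ i → f i ≡ j) (λ j → any? (λ i → f i ≟ j)) ¬surjective
  where
  ¬surjective : ¬ (∀ j → ∃ λ i → f i ≡ j)
  ¬surjective preimage with pigeonhole k<m (λ j → proj₁ (preimage j))
  ... | j₁ , j₂ , j₁<j₂ , same-preimage =
    <⇒≢ j₁<j₂ (trans (sym (proj₂ (preimage j₁)))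
                (trans (cong f same-preimage) (proj₂ (preimage j₂))))
... | j , unhit = j , λ i fi≡j → unhit (i , fi≡j)

module _ {n : ℕ} (I : Set) (CA : I → Fin n → Fin n → Set)
         (RA : Fin n → Fin n → Set) where
  open Game I CA RA

  CopWin-one-step : DecidableEquality I →
                    ∀ cs r i → Step (CA i) (cs i) r → CopWin cs r
  CopWin-one-step _≟ᵢ_ cs r i step = move cs′ cops-step (inj₁ (i , cs′-i≡r))
    where
    cs′ : Pos
    cs′ i′ with i′ ≟ᵢ i
    ... | yes _ = r
    ... | no _ = cs i′

    cops-step : CopsStep cs cs′
    cops-step i′ with i′ ≟ᵢ i
    ... | yes refl = step
    ... | no _ = inj₁ refl

    cs′-i≡r : cs′ i ≡ r
    cs′-i≡r with i ≟ᵢ i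
    ... | yes _ = refl
    ... | no i≢i = contradiction refl i≢i

module _ {n m : ℕ} (I : Set) (CA : I → Fin n → Fin n → Set)
         (RA : Fin n → Fin n → Set) (class : Fin n → Fin m)
         (CA⇒same-class : ∀ i {u v} → CA i u v → class u ≡ class v) where
  open Game I CA RA

  -- The robber never moves: no cop can ever enter its class.
  ¬CopWin-unvisited-class : ∀ cs r → (∀ i → class (cs i) ≢ class r) → ¬ CopWin cs r
  ¬CopWin-unvisited-class cs r away (caught (i , cᵢ≡r)) = away i (cong class cᵢ≡r)
  ¬CopWin-unvisited-class cs r away (move cs′ step next) = survive next
    where
    away′ : ∀ i → class (cs′ i) ≢ class r
    away′ i with step i
    ... | inj₁ cᵢ≡cᵢ′ = subst (λ c → class c ≢ class r) cᵢ≡cᵢ′ (away i)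
    ... | inj₂ adj = subst (_≢ class r) (CA⇒same-class i adj) (away i)

    survive : Caught cs′ r ⊎ (∀ r′ → Step RA r r′ → CopWin cs′ r′) → ⊥
    survive (inj₁ (i , cᵢ′≡r)) = away′ i (cong class cᵢ′≡r)
    survive (inj₂ reply) = ¬CopWin-unvisited-class cs′ r away′ (reply r (inj₁ refl))

record DominatedPartition {A : Set} (e : A → A → Bool) (m : ℕ) : Set where
  field
    class            : A → Fin m
    centre           : Fin m → A
    class-centre     : ∀ j → class (centre j) ≡ j
    edge⇒same-class  : ∀ {u v} → e u v ≡ true → class u ≡ class v
    centre-dominates : ∀ v → centre (class v) ≡ v ⊎ e (centre (class v)) v ≡ true

open DominatedPartition

pullback : ∀ {A B : Set} {e : B → B → Bool} {m} (iso : A ↔ B) →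
            DominatedPartition e m →
            DominatedPartition (λ u v → e (Inverse.to iso u) (Inverse.to iso v)) m
pullback {e = e} iso P = record
  { class            = class P ∘ to
  ; centre           = from ∘ centre P
  ; class-centre     = λ j → trans (cong (class P) (to∘from (centre P j))) (class-centre P j)
  ; edge⇒same-class  = edge⇒same-class P
  ; centre-dominates = dominates
  }
  where
  open Inverse iso using (to; from)
    renaming (strictlyInverseˡ to to∘from; strictlyInverseʳ to from∘to)
  dominates : ∀ v → from (centre P (class P (to v))) ≡ v ⊎
                    e (to (from (centre P (class P (to v))))) (to v) ≡ true
  dominates v with centre-dominates P (to v)
  ... | inj₁ centre≡v = inj₁ (trans (cong from centre≡v) (from∘to v))
  ... | inj₂ edge = inj₂ (subst (λ x → e x (to v) ≡ true) (sym (to∘from _)) edge)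

module _ {n m : ℕ} {E : Edges n} (P : DominatedPartition E m) where

  Adj⇒same-class : ∀ {u v} → Adj E u v → class P u ≡ class P v
  Adj⇒same-class (_ , inj₁ edge) = edge⇒same-class P edge
  Adj⇒same-class (_ , inj₂ edge) = sym (edge⇒same-class P edge)

  centre-step : ∀ v → Step (Adj E) (centre P (class P v)) v
  centre-step v with centre P (class P v) ≟ v | centre-dominates P v
  ... | yes centre≡v | _             = inj₁ centre≡v
  ... | no centre≢v  | inj₁ centre≡v = contradiction centre≡v centre≢v
  ... | no centre≢v  | inj₂ edge     = inj₂ (centre≢v , inj₁ edge)

  ¬CopWin-at-missed-centre : ∀ {I : Set} {CA : I → Fin n → Fin n → Set} {RA} →
    (∀ i {u v} → CA i u v → class P u ≡ class P v) →
    ∀ cs j → (∀ i → class P (cs i) ≢ j) → ¬ Game.CopWin I CA RA cs (centre P j)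
  ¬CopWin-at-missed-centre {I} {CA} {RA} CA⇒same-class cs j unhit =
    ¬CopWin-unvisited-class I CA RA (class P) CA⇒same-class cs (centre P j)
      (λ i → subst (class P (cs i) ≢_) (sym (class-centre P j)) (unhit i))

  cop-number : IsCopNumber E m
  cop-number = (centre P , win) , lose
    where
    win : ∀ r → Game.CopWin (Fin m) (λ _ → Adj E) (Adj E) (centre P) r
    win r = CopWin-one-step (Fin m) (λ _ → Adj E) (Adj E) _≟_
              (centre P) r (class P r) (centre-step r)

    lose : ∀ k → k < m → ¬ ClassicalCopsWin E k
    lose k k<m (cs , win) with missed-value k<m (class P ∘ cs)
    ... | j , unhit =
      ¬CopWin-at-missed-centre (λ _ → Adj⇒same-class) cs j unhit (win (centre P j))

module _ {n τ m : ℕ} (C : Fin τ → Edges n) (R : Fin n → Fin n → Set)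
         {ℓ : Fin τ} (P : DominatedPartition (C ℓ) m) where

  ¬MultiLayerCopsWin-one-layer : (a : Vec ℕ τ) → (∀ ℓ′ → Fin (lookup a ℓ′) → ℓ′ ≡ ℓ) →
                                 lookup a ℓ < m → ¬ MultiLayerCopsWin C R a
  ¬MultiLayerCopsWin-one-layer a only-ℓ a-ℓ<m (cs , win)
    with missed-value a-ℓ<m (λ t → class P (cs (ℓ , t)))
  ... | j , unhit = ¬CopWin-at-missed-centre P same-class cs j away (win (centre P j))
    where
    same-class : ∀ i {u v} → Adj (C (proj₁ i)) u v → class P u ≡ class P v
    same-class (ℓ′ , t) with only-ℓ ℓ′ t
    ... | refl = Adj⇒same-class P

    away : ∀ i → class P (cs i) ≢ j
    away (ℓ′ , t) with only-ℓ ℓ′ t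
    ... | refl = unhit t

module _ {n m₁ m₂ : ℕ} {E₁ E₂ : Edges n}
         (P₁ : DominatedPartition E₁ m₁) (P₂ : DominatedPartition E₂ m₂)
         (1<m₁ : 1 < m₁) (1<m₂ : 1 < m₂) where

  private
    Layers : Fin 2 → Edges n
    Layers = lookup (E₁ ∷ E₂ ∷ [])

  multi-layer-cop-number-two :
    (j₁ : Fin m₁) (j₂ : Fin m₂) → (∀ v → class P₁ v ≡ j₁ ⊎ class P₂ v ≡ j₂) →
    IsMultiLayerCopNumber Layers (UnionAdj Layers) 2
  multi-layer-cop-number-two j₁ j₂ covered = ((1 ∷ 1 ∷ []) , refl , cs , win) , lose
    where
    I : Set
    I = Σ (Fin 2) λ ℓ → Fin (lookup (1 ∷ 1 ∷ []) ℓ)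

    cs : I → Fin n
    cs (zero , zero) = centre P₁ j₁
    cs (suc zero , zero) = centre P₂ j₂

    catch : ∀ r i → Step (Adj (Layers (proj₁ i))) (cs i) r →
            Game.CopWin I (λ i → Adj (Layers (proj₁ i))) (UnionAdj Layers) cs r
    catch = CopWin-one-step I _ (UnionAdj Layers) (≡-dec _≟_ _≟_) cs

    win : ∀ r → Game.CopWin I (λ i → Adj (Layers (proj₁ i))) (UnionAdj Layers) cs r
    win r with covered r
    ... | inj₁ refl = catch r (zero , zero) (centre-step P₁ r)
    ... | inj₂ refl = catch r (suc zero , zero) (centre-step P₂ r)

    only-first : ∀ {x} ℓ → Fin (lookup (x ∷ 0 ∷ []) ℓ) → ℓ ≡ zero
    only-first zero _ = refl
    only-first (suc zero) ()

    only-second : ∀ {y} ℓ → Fin (lookup (0 ∷ y ∷ []) ℓ) → ℓ ≡ suc zero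
    only-second zero ()
    only-second (suc zero) _ = refl

    lose : ∀ k → k < 2 → ¬ MultiLayerWinsWith Layers (UnionAdj Layers) k
    lose _ _ ((0 ∷ 0 ∷ []) , refl , w) =
      ¬MultiLayerCopsWin-one-layer Layers _ P₁ (0 ∷ 0 ∷ []) only-first (<-trans z<s 1<m₁) w
    lose _ _ ((1 ∷ 0 ∷ []) , refl , w) =
      ¬MultiLayerCopsWin-one-layer Layers _ P₁ (1 ∷ 0 ∷ []) only-first 1<m₁ w
    lose _ _ ((0 ∷ 1 ∷ []) , refl , w) =
      ¬MultiLayerCopsWin-one-layer Layers _ P₂ (0 ∷ 1 ∷ []) only-second 1<m₂ w
    lose _ (s≤s (s≤s ())) ((suc (suc _) ∷ _ ∷ []) , refl , _)
    lose _ (s≤s (s≤s ())) ((1 ∷ suc _ ∷ []) , refl , _)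
    lose _ (s≤s (s≤s ())) ((0 ∷ suc (suc _) ∷ []) , refl , _)

star : ∀ {a b} → Fin (suc a) ⊎ Fin b → Fin (suc a) ⊎ Fin b → Bool
star (inj₁ zero) (inj₁ (suc _)) = true
star _           _              = false

star-class : ∀ {a b} → Fin (suc a) ⊎ Fin b → Fin (suc b)
star-class (inj₁ _) = zero
star-class (inj₂ t) = suc t

star-edge⇒same-class : ∀ {a b} {u v : Fin (suc a) ⊎ Fin b} →
                       star u v ≡ true → star-class u ≡ star-class v
star-edge⇒same-class {u = inj₁ zero}    {inj₁ (suc _)} _ = refl
star-edge⇒same-class {u = inj₁ zero}    {inj₁ zero}    ()
star-edge⇒same-class {u = inj₁ zero}    {inj₂ _}       ()
star-edge⇒same-class {u = inj₁ (suc _)}                ()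
star-edge⇒same-class {u = inj₂ _}                      ()

star-partition : ∀ {a b} → DominatedPartition (star {a} {b}) (suc b)
star-partition = record
  { class            = star-class
  ; centre           = λ { zero → inj₁ zero ; (suc t) → inj₂ t }
  ; class-centre     = λ { zero → refl ; (suc _) → refl }
  ; edge⇒same-class  = star-edge⇒same-class
  ; centre-dominates = λ { (inj₁ zero)    → inj₁ refl
                         ; (inj₁ (suc _)) → inj₂ refl
                         ; (inj₂ _)       → inj₁ refl }
  }

star-class-or-swapped : ∀ {a} (x : Fin (suc a) ⊎ Fin (suc a)) →
                        star-class x ≡ zero ⊎ star-class (swap x) ≡ zero
star-class-or-swapped (inj₁ _) = inj₁ refl
star-class-or-swapped (inj₂ _) = inj₂ refl

module TwoStars (c : ℕ) where

  Half : Set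
  Half = Fin (suc c)

  layer : (Fin (suc c + suc c) ↔ (Half ⊎ Half)) → Edges (suc c + suc c)
  layer iso u v = star (Inverse.to iso u) (Inverse.to iso v)

  left-star right-star : Fin (suc c + suc c) ↔ (Half ⊎ Half)
  left-star  = +↔⊎
  right-star = swap-↔ ↔-∘ +↔⊎

  partition : (iso : Fin (suc c + suc c) ↔ (Half ⊎ Half)) →
              DominatedPartition (layer iso) (suc (suc c))
  partition iso = pullback iso star-partition

  centres-cover : ∀ v → class (partition left-star) v ≡ zero ⊎
                        class (partition right-star) v ≡ zero
  centres-cover v = star-class-or-swapped (Inverse.to +↔⊎ v)

proposition3p4 : (c : ℕ) → 2 ≤ c →
    Σ ℕ λ n → Σ (Edges n) λ E₁ → Σ (Edges n) λ E₂ →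
    (Σ ℕ λ m₁ → IsCopNumber E₁ m₁ × c ≤ m₁) ×
    (Σ ℕ λ m₂ → IsCopNumber E₂ m₂ × c ≤ m₂) ×
    IsMultiLayerCopNumber (lookup (E₁ ∷ E₂ ∷ [])) (UnionAdj (lookup (E₁ ∷ E₂ ∷ []))) 2
proposition3p4 c _ =
  suc c + suc c , layer left-star , layer right-star ,
  (suc (suc c) , cop-number (partition left-star) , m≤n+m c 2) ,
  (suc (suc c) , cop-number (partition right-star) , m≤n+m c 2) ,
  multi-layer-cop-number-two (partition left-star) (partition right-star)
    (s≤s (s≤s z≤n)) (s≤s (s≤s z≤n)) zero zero centres-cover
  where open TwoStars c
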